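{- Let $J\in\Theta$ be a graph which is not a cycle, let $\{J_1,J_2,J_3\}$ be a partition of $V(J)$ into three independent sets, and let $u\in V(J)$ be a vertex of degree $2$. If $\{U,W\}$ is a partition of $V(J-u)$ which is compatible (with respect to the plane graph $J-u$) with $\{J_1\setminus\{u\},J_2\setminus\{u\},J_3\setminus\{u\}\}$ and both $U$ and $W$ induce a forest in $J-u$, then there exists a partition $\mathcal{K}$ of $V(J)$ into two parts which is compatible with $\{J_1,J_2,J_3\}$ and such that each part of $\mathcal{K}$ induces a forest in $J$.
   Context: All graphs are finite and simple. $\Theta$ denotes the family of all $2$-connected $3$-colourable plane graphs in which every face is bounded by a $3$-cycle or a $4$-cycle. Compatibility: for a plane graph $H$ and a partition $\mathcal{H}$ of $V(H)$ into three (possibly empty) independent sets, a partition $\mathcal{K}$ of $V(H)$ into two subsets is compatible with $\mathcal{H}$ if every facial $4$-cycle of $H$ has two non-consecutive vertices which either belong to the same part of $\mathcal{K}$ and the same part of $\mathcal{H}$, or belong to distinct parts of $\mathcal{K}$ and distinct parts of $\mathcal{H}$. -}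

module Defs where

open import Data.Nat using (ℕ; zero; suc; _+_; _≤_)
open import Data.Bool using (Bool; true; false; T)
open import Data.Fin using (Fin; zero; suc; inject₁; fromℕ; punchIn)
open import Data.List using (length; filterᵇ; allFin)
open import Data.Product using (Σ; ∃; ∃-syntax; _×_; _,_)
open import Data.Sum using (_⊎_)
open import Data.Empty using (⊥)
open import Relation.Nullary using (¬_)
open import Relation.Binary.PropositionalEquality using (_≡_; _≢_)
open import Relation.Binary.Construct.Closure.ReflexiveTransitive using (Star)
open import Function.Bundles using (_↔_; _⇔_)
open import Function.Definitions using (Injective)

-- Combinatorial maps (graphs with a rotation system) on vertex set Fin n.
--   adj v w     : v and w are adjacent
--   rot v w w'  : around vertex v, the neighbour w' immediately follows
--                 the neighbour w in the (clockwise) cyclic order.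
-- Faces are the orbits of the dart map (v→w) ↦ (w→w') with rot w v w'.

record Map (n : ℕ) : Set₁ where
  field
    adj : Fin n → Fin n → Bool
    rot : Fin n → Fin n → Fin n → Set

module _ {n : ℕ} (G : Map n) where
  open Map G

  Edge : Fin n → Fin n → Set
  Edge v w = T (adj v w)

  degree : Fin n → ℕ
  degree v = length (filterᵇ (adj v) (allFin n))

  IsSimple : Set
  IsSimple = (∀ v → adj v v ≡ false) × (∀ v w → adj v w ≡ adj w v)

  -- rot v is a cyclic permutation of the neighbourhood of v
  IsRotationSystem : Set
  IsRotationSystem =
      (∀ v w w' → rot v w w' → Edge v w × Edge v w')
    × (∀ v w w₁ w₂ → rot v w w₁ → rot v w w₂ → w₁ ≡ w₂)
    × (∀ v w₁ w₂ w → rot v w₁ w → rot v w₂ w → w₁ ≡ w₂)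
    × (∀ v w → Edge v w → ∃[ w' ] rot v w w')
    × (∀ v w w' → Edge v w → Edge v w' → Star (rot v) w w')

  Dart : Set
  Dart = Σ (Fin n × Fin n) (λ { (v , w) → Edge v w })

  FaceStep : Dart → Dart → Set
  FaceStep ((v , w) , _) ((w' , x) , _) = (w' ≡ w) × rot w v x

  SameFace : Dart → Dart → Set
  SameFace = Star FaceStep

  HasFaceCount : ℕ → Set
  HasFaceCount F = Σ (Dart → Fin F) λ f →
      (∀ i → ∃[ d ] f d ≡ i)
    × (∀ d d' → (f d ≡ f d') ⇔ SameFace d d')

  Connected : Set
  Connected = ∀ v w → Star Edge v w

  ConnectedWithout : Fin n → Set
  ConnectedWithout x = ∀ v w → v ≢ x → w ≢ x →
    Star (λ a b → Edge a b × a ≢ x × b ≢ x) v w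

  TwoConnected : Set
  TwoConnected = (3 ≤ n) × Connected × (∀ x → ConnectedWithout x)

  -- plane graph: simple connected graph with a rotation system of genus 0
  -- (Euler: V - E + F = 2, with E = (number of darts)/2)
  IsPlaneGraph : Set
  IsPlaneGraph = IsSimple × IsRotationSystem × Connected ×
    Σ ℕ λ D → Σ ℕ λ F → (Dart ↔ Fin D) × HasFaceCount F × (2 * n + 2 * F ≡ 4 + D)
    where open import Data.Nat using (_*_)

  -- the face traced from dart (v0→v1) is bounded by the 3-cycle v0 v1 v2
  Face3 : Fin n → Fin n → Fin n → Set
  Face3 v0 v1 v2 = (v0 ≢ v1 × v1 ≢ v2 × v0 ≢ v2)
    × rot v1 v0 v2 × rot v2 v1 v0 × rot v0 v2 v1

  -- the face traced from dart (v0→v1) is bounded by the 4-cycle v0 v1 v2 v3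
  Face4 : Fin n → Fin n → Fin n → Fin n → Set
  Face4 v0 v1 v2 v3 =
      (v0 ≢ v1 × v0 ≢ v2 × v0 ≢ v3 × v1 ≢ v2 × v1 ≢ v3 × v2 ≢ v3)
    × rot v1 v0 v2 × rot v2 v1 v3 × rot v3 v2 v0 × rot v0 v3 v1

  -- proper colouring = partition into three (possibly empty) independent sets
  ProperColouring : (Fin n → Fin 3) → Set
  ProperColouring c = ∀ v w → Edge v w → c v ≢ c w

  ThreeColourable : Set
  ThreeColourable = ∃[ c ] ProperColouring c

  InTheta : Set
  InTheta = TwoConnected × ThreeColourable × IsPlaneGraph ×
    (∀ v0 v1 → Edge v0 v1 →
      (∃[ v2 ] Face3 v0 v1 v2) ⊎ (∃[ v2 ] ∃[ v3 ] Face4 v0 v1 v2 v3))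

  IsCycleSeq : (k : ℕ) → (Fin (3 + k) → Fin n) → Set
  IsCycleSeq k f = Injective _≡_ _≡_ f
    × (∀ (i : Fin (2 + k)) → Edge (f (inject₁ i)) (f (suc i)))
    × Edge (f (fromℕ (2 + k))) (f zero)

  IsCycleGraph : Set
  IsCycleGraph = Σ ℕ λ k → Σ (Fin (3 + k) → Fin n) λ f → IsCycleSeq k f
    × (∀ v → ∃[ i ] f i ≡ v)
    × (∀ v w → Edge v w →
         ∃[ i ] ((f (inject₁ i) ≡ v × f (suc i) ≡ w) ⊎ (f (inject₁ i) ≡ w × f (suc i) ≡ v))
         ⊎ ((f (fromℕ (2 + k)) ≡ v × f zero ≡ w) ⊎ (f (fromℕ (2 + k)) ≡ w × f zero ≡ v)))

  InducesForest : (Fin n → Set) → Set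
  InducesForest S = ∀ k (f : Fin (3 + k) → Fin n) → IsCycleSeq k f → (∀ i → S (f i)) → ⊥

  GoodPair : (Fin n → Fin 3) → (Fin n → Bool) → Fin n → Fin n → Set
  GoodPair c K x y = (K x ≡ K y × c x ≡ c y) ⊎ (K x ≢ K y × c x ≢ c y)

  Compatible : (Fin n → Fin 3) → (Fin n → Bool) → Set
  Compatible c K = ∀ v0 v1 v2 v3 → Face4 v0 v1 v2 v3 →
    GoodPair c K v0 v2 ⊎ GoodPair c K v1 v3

-- deletion of a vertex u, with the induced rotation system (plane graph J - u);
-- vertices of J - u are indexed by Fin m via punchIn u.
deleteVertex : {m : ℕ} → Map (suc m) → Fin (suc m) → Map m
deleteVertex {m} G u = record
  { adj = λ v w → adj (punchIn u v) (punchIn u w)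
  ; rot = λ v w w' → rot (punchIn u v) (punchIn u w) (punchIn u w')
                   ⊎ (rot (punchIn u v) (punchIn u w) u × rot (punchIn u v) u (punchIn u w'))
  }
  where open Map G

-- Extend the partition of J - u by putting u into a part β.  A cycle of J through u uses
-- both neighbours a, b of u, so both parts stay forests as long as a and b are not both
-- in part β.  Facial 4-cycles avoiding u are facial in J - u, and the two faces at u are
-- u a b or u a x b, and u b a or u b y a.  Beside a triangle u a b the proper colouring
-- forces c y = c u, so β = k y works.  If both faces are squares, either a, b is already a
-- good pair, or x = y and J is the 4-cycle u a x b, or a x b y is a facial 4-cycle of J - u;
-- then x, y is a good pair, which is exactly what lets one β suit both faces at u.
module Submission where

open import Defs
open import Data.Nat as ℕ using (ℕ; suc; _+_)
open import Data.Nat.Properties using (n<1+n; m<n⇒m<1+n) renaming (<⇒≢ to <⇒≢ⁿ)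
open import Data.Bool using (Bool; true; false; not; T)
open import Data.Bool.Properties using () renaming (_≟_ to _≟ᵇ_)
open import Data.Fin using (Fin; zero; suc; punchIn; punchOut; inject₁; fromℕ; toℕ)
open import Data.Fin.Properties
  using (all?; any?; _≟_; pigeonhole; <⇒≢; punchIn-punchOut; punchInᵢ≢i; punchIn-injective; toℕ-inject₁)
open import Data.List using ([]; _∷_; filterᵇ; allFin)
open import Data.List.Membership.Propositional using (_∈_)
open import Data.List.Membership.Propositional.Properties using (∈-filter⁺; ∈-filter⁻; ∈-allFin)
open import Data.List.Relation.Unary.Any using (here; there)
open import Data.Product using (∃; ∃₂; ∃-syntax; _×_; _,_; proj₁; proj₂)
open import Data.Sum using (_⊎_; inj₁; inj₂; swap; map; map₁; map₂)
open import Data.Empty using (⊥-elim)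
open import Relation.Nullary using (¬_; Dec; yes; no)
open import Relation.Nullary.Decidable using (from-yes; _×-dec_; _⊎-dec_; _→-dec_; ¬?; T?)
open import Relation.Binary.PropositionalEquality
  using (_≡_; _≢_; ≢-sym; refl; sym; trans; cong; subst; subst₂; module ≡-Reasoning)
open import Relation.Binary.Construct.Closure.ReflexiveTransitive using (Star; ε; _◅_)
open import Function using (_∘_; Injective)
open import Data.Vec using ([]; _∷_; lookup)
open import Data.Vec.Relation.Unary.All using ([]; _∷_)
open import Data.Vec.Relation.Unary.AllPairs using ([]; _∷_)
open import Data.Vec.Relation.Unary.Unique.Propositional using (Unique)
open import Data.Vec.Relation.Unary.Unique.Propositional.Properties using (lookup-injective)

Good : Bool → Fin 3 → Bool → Fin 3 → Set
Good κ γ κ′ γ′ = (κ ≡ κ′ × γ ≡ γ′) ⊎ (κ ≢ κ′ × γ ≢ γ′)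

good? : ∀ κ γ κ′ γ′ → Dec (Good κ γ κ′ γ′)
good? κ γ κ′ γ′ = ((κ ≟ᵇ κ′) ×-dec (γ ≟ γ′)) ⊎-dec (¬? (κ ≟ᵇ κ′) ×-dec ¬? (γ ≟ γ′))

good-sym : ∀ {κ γ κ′ γ′} → Good κ γ κ′ γ′ → Good κ′ γ′ κ γ
good-sym (inj₁ (p , q)) = inj₁ (sym p , sym q)
good-sym (inj₂ (p , q)) = inj₂ (≢-sym p , ≢-sym q)

all-Bool? : {P : Bool → Set} → (∀ b → Dec (P b)) → Dec (∀ b → P b)
all-Bool? P? with P? true | P? false
... | yes p | yes q = yes λ { true → p ; false → q }
... | no ¬p | _     = no λ f → ¬p (f true)
... | yes _ | no ¬q = no λ f → ¬q (f false)

any-Bool? : {P : Bool → Set} → (∀ b → Dec (P b)) → Dec (∃ P)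
any-Bool? P? with P? true | P? false
... | yes p | _     = yes (true , p)
... | no _  | yes q = yes (false , q)
... | no ¬p | no ¬q = no λ { (true , p) → ¬p p ; (false , q) → ¬q q }

b≢not-b : ∀ b → b ≢ not b
b≢not-b true  ()
b≢not-b false ()

-- Good β γu κ γ forces β = κ or β = not κ according as γu = γ.  If γa = γb, then γu, γx, γy
-- avoid γa, so Good x y makes the β forced by x and by y agree; if γa ≠ γb, then γu = γx = γy.
abstract
  square-label-choice : ∀ (γa γb γu γx γy : Fin 3) (κa κb κx κy : Bool) →
    γa ≢ γu → γb ≢ γu → γa ≢ γx → γb ≢ γx → γa ≢ γy → γb ≢ γy →
    ¬ Good κa γa κb γb → Good κx γx κy γy → ¬ (κa ≡ κx × κb ≡ κx × κy ≡ κx) →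
    ∃ λ β → Good β γu κx γx × Good β γu κy γy × ¬ (κa ≡ β × κb ≡ β)
  square-label-choice = from-yes
    (all? λ γa → all? λ γb → all? λ γu → all? λ γx → all? λ γy →
     all-Bool? λ κa → all-Bool? λ κb → all-Bool? λ κx → all-Bool? λ κy →
       ¬? (γa ≟ γu) →-dec ¬? (γb ≟ γu) →-dec ¬? (γa ≟ γx) →-dec ¬? (γb ≟ γx) →-dec
       ¬? (γa ≟ γy) →-dec ¬? (γb ≟ γy) →-dec
       ¬? (good? κa γa κb γb) →-dec good? κx γx κy γy →-dec
       ¬? ((κa ≟ᵇ κx) ×-dec (κb ≟ᵇ κx) ×-dec (κy ≟ᵇ κx)) →-dec
       any-Bool? λ β → good? β γu κx γx ×-dec good? β γu κy γy ×-dec ¬? ((κa ≟ᵇ β) ×-dec (κb ≟ᵇ β)))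

third-colour : ∀ {γ₁ γ₂ γ₃ γ : Fin 3} → γ₁ ≢ γ₂ → γ₁ ≢ γ₃ → γ₂ ≢ γ₃ → γ ≢ γ₁ → γ ≢ γ₂ → γ ≡ γ₃
third-colour {γ₃ = γ₃} {γ} γ₁≢γ₂ γ₁≢γ₃ γ₂≢γ₃ γ≢γ₁ γ≢γ₂ with γ ≟ γ₃
... | yes γ≡γ₃ = γ≡γ₃
... | no γ≢γ₃ with pigeonhole (n<1+n 3) (lookup (_ ∷ _ ∷ _ ∷ γ ∷ []))
...   | i , j , i<j , collision = ⊥-elim (<⇒≢ i<j (lookup-injective distinct i j collision))
  where
  distinct : Unique (_ ∷ _ ∷ _ ∷ γ ∷ [])
  distinct = (γ₁≢γ₂ ∷ γ₁≢γ₃ ∷ ≢-sym γ≢γ₁ ∷ [])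
           ∷ (γ₂≢γ₃ ∷ ≢-sym γ≢γ₂ ∷ []) ∷ (≢-sym γ≢γ₃ ∷ []) ∷ [] ∷ []

successor-view : ∀ {n} (j : Fin (suc n)) → j ≡ fromℕ n ⊎ ∃[ j′ ] inject₁ j′ ≡ suc j
successor-view {ℕ.zero} zero    = inj₁ refl
successor-view {suc n}  zero    = inj₂ (suc zero , refl)
successor-view {suc n}  (suc j) with successor-view j
... | inj₁ j≡max      = inj₁ (cong suc j≡max)
... | inj₂ (j′ , j′≡) = inj₂ (suc j′ , cong suc j′≡)

inject₁≢suc : ∀ {n} {j j′ : Fin (suc n)} → inject₁ j′ ≡ suc j → inject₁ j ≢ suc j′
inject₁≢suc {j = j} {j′} j′≡ j≡ = <⇒≢ⁿ (m<n⇒m<1+n (n<1+n (toℕ j))) (begin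
  toℕ j                  ≡⟨ sym (toℕ-inject₁ j) ⟩
  toℕ (inject₁ j)        ≡⟨ cong toℕ j≡ ⟩
  suc (toℕ j′)           ≡⟨ cong suc (sym (toℕ-inject₁ j′)) ⟩
  suc (toℕ (inject₁ j′)) ≡⟨ cong (suc ∘ toℕ) j′≡ ⟩
  suc (suc (toℕ j))      ∎)
  where open ≡-Reasoning

module _ {n : ℕ} (G : Map n) where
  open Map G using (rot)

  triangle-cycle : ∀ {p q r} → p ≢ q → p ≢ r → q ≢ r →
    Edge G p q → Edge G q r → Edge G r p → IsCycleSeq G 0 (lookup (p ∷ q ∷ r ∷ []))
  triangle-cycle p≢q p≢r q≢r pq qr rp =
      (λ {i} {j} → lookup-injective ((p≢q ∷ p≢r ∷ []) ∷ (q≢r ∷ []) ∷ [] ∷ []) i j)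
    , (λ { zero → pq ; (suc zero) → qr })
    , rp

  square-cycle : ∀ {p q r s} → p ≢ q → p ≢ r → p ≢ s → q ≢ r → q ≢ s → r ≢ s →
    Edge G p q → Edge G q r → Edge G r s → Edge G s p → IsCycleSeq G 1 (lookup (p ∷ q ∷ r ∷ s ∷ []))
  square-cycle p≢q p≢r p≢s q≢r q≢s r≢s pq qr rs sp =
      (λ {i} {j} → lookup-injective
         ((p≢q ∷ p≢r ∷ p≢s ∷ []) ∷ (q≢r ∷ q≢s ∷ []) ∷ (r≢s ∷ []) ∷ [] ∷ []) i j)
    , (λ { zero → pq ; (suc zero) → qr ; (suc (suc zero)) → rs })
    , sp

  module _ (k : Fin n → Bool) (forest : ∀ t → InducesForest G (λ v → k v ≡ t)) where

    triangle-not-monochromatic : ∀ {p q r} → p ≢ q → p ≢ r → q ≢ r →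
      Edge G p q → Edge G q r → Edge G r p → ¬ (k p ≡ k r × k q ≡ k r)
    triangle-not-monochromatic {r = r} p≢q p≢r q≢r pq qr rp (kp , kq) =
      forest (k r) 0 _ (triangle-cycle p≢q p≢r q≢r pq qr rp)
        λ { zero → kp ; (suc zero) → kq ; (suc (suc zero)) → refl }

    square-not-monochromatic : ∀ {p q r s} → p ≢ q → p ≢ r → p ≢ s → q ≢ r → q ≢ s → r ≢ s →
      Edge G p q → Edge G q r → Edge G r s → Edge G s p → ¬ (k p ≡ k q × k r ≡ k q × k s ≡ k q)
    square-not-monochromatic {q = q} p≢q p≢r p≢s q≢r q≢s r≢s pq qr rs sp (kp , kr , ks) =
      forest (k q) 1 _ (square-cycle p≢q p≢r p≢s q≢r q≢s r≢s pq qr rs sp)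
        λ { zero → kp ; (suc zero) → refl ; (suc (suc zero)) → kr ; (suc (suc (suc zero))) → ks }

  CycleEdge : ∀ k → (Fin (3 + k) → Fin n) → Fin n → Fin n → Set
  CycleEdge k f v w =
      ∃[ i ] ((f (inject₁ i) ≡ v × f (suc i) ≡ w) ⊎ (f (inject₁ i) ≡ w × f (suc i) ≡ v))
    ⊎ ((f (fromℕ (2 + k)) ≡ v × f zero ≡ w) ⊎ (f (fromℕ (2 + k)) ≡ w × f zero ≡ v))

  cycle-edge-target : ∀ {k f v w} → CycleEdge k f v w → ∃[ i ] f i ≡ w
  cycle-edge-target         (inj₁ (i , inj₁ (_ , w≡))) = suc i , w≡
  cycle-edge-target         (inj₁ (i , inj₂ (w≡ , _))) = inject₁ i , w≡
  cycle-edge-target         (inj₂ (inj₁ (_ , w≡)))     = zero , w≡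
  cycle-edge-target {k = k} (inj₂ (inj₂ (w≡ , _)))     = fromℕ (2 + k) , w≡

  connected-cycle-graph : Connected G → ∀ {k f} → IsCycleSeq G k f →
    (∀ i w → Edge G (f i) w → CycleEdge k f (f i) w) → IsCycleGraph G
  connected-cycle-graph connected {k} {f} cycle closed = k , f , cycle , on-cycle , edge-on-cycle
    where
    reach : ∀ {v w} → Star (Edge G) v w → ∃[ i ] f i ≡ v → ∃[ i ] f i ≡ w
    reach ε        v-on       = v-on
    reach (e ◅ es) (i , refl) = reach es (cycle-edge-target (closed i _ e))

    on-cycle : ∀ v → ∃[ i ] f i ≡ v
    on-cycle v = reach (connected (f zero) v) (zero , refl)

    edge-on-cycle : ∀ v w → Edge G v w → CycleEdge k f v w
    edge-on-cycle v w e with on-cycle v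
    ... | i , refl = closed i w e

  cycle-neighbours : (∀ {v w} → Edge G v w → Edge G w v) → ∀ {k f} → IsCycleSeq G k f → ∀ i →
    ∃₂ λ j j′ → j ≢ j′ × Edge G (f i) (f j) × Edge G (f i) (f j′)
  cycle-neighbours edge-sym {k} (_ , path , closing) zero =
    suc zero , fromℕ (2 + k) , (λ ()) , path zero , edge-sym closing
  cycle-neighbours edge-sym {k} {f} (_ , path , closing) (suc j) with successor-view j
  ... | inj₁ refl      = inject₁ j , zero , (λ ()) , edge-sym (path j) , closing
  ... | inj₂ (j′ , j′≡) =
    inject₁ j , suc j′ , inject₁≢suc j′≡ , edge-sym (path j) , subst (λ i → Edge G (f i) (f (suc j′))) j′≡ (path j′)

  rotate-Face4 : ∀ {v₀ v₁ v₂ v₃} → Face4 G v₀ v₁ v₂ v₃ → Face4 G v₁ v₂ v₃ v₀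
  rotate-Face4 ((d₀₁ , d₀₂ , d₀₃ , d₁₂ , d₁₃ , d₂₃) , r₁ , r₂ , r₃ , r₀) =
    (d₁₂ , d₁₃ , ≢-sym d₀₁ , d₂₃ , ≢-sym d₀₂ , ≢-sym d₀₃) , r₂ , r₃ , r₀ , r₁

  degree-two-neighbours : ∀ {u} → degree G u ≡ 2 →
    ∃₂ λ a b → Edge G u a × Edge G u b × (∀ w → Edge G u w → w ≡ a ⊎ w ≡ b)
  degree-two-neighbours {u} deg with filterᵇ (Map.adj G u) (allFin n) in nbrs
  ... | a ∷ b ∷ [] = a , b , is-neighbour (here refl) , is-neighbour (there (here refl)) , only
    where
    is-neighbour : ∀ {w} → w ∈ a ∷ b ∷ [] → Edge G u w
    is-neighbour w∈ = proj₂ (∈-filter⁻ (T? ∘ Map.adj G u) {xs = allFin n} (subst (_ ∈_) (sym nbrs) w∈))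
    only : ∀ w → Edge G u w → w ≡ a ⊎ w ≡ b
    only w e with subst (w ∈_) nbrs (∈-filter⁺ (T? ∘ Map.adj G u) (∈-allFin w) e)
    ... | here w≡a         = inj₁ w≡a
    ... | there (here w≡b) = inj₂ w≡b
  degree-two-neighbours () | []
  degree-two-neighbours () | _ ∷ []
  degree-two-neighbours () | _ ∷ _ ∷ _ ∷ _

  module _ (rotation : IsRotationSystem G) where

    rot-edges : ∀ {v w w′} → rot v w w′ → Edge G v w × Edge G v w′
    rot-edges = proj₁ rotation _ _ _

    rot-functional : ∀ {v w w₁ w₂} → rot v w w₁ → rot v w w₂ → w₁ ≡ w₂
    rot-functional = proj₁ (proj₂ rotation) _ _ _ _

    rot-involution-neighbours : ∀ {v p q} → rot v p q → rot v q p → ∀ w → Edge G v w → w ≡ p ⊎ w ≡ q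
    rot-involution-neighbours {v} {p} {q} pq qp w e = go (inj₁ refl) (orbit (proj₁ (rot-edges pq)) e)
      where
      orbit : Edge G v p → Edge G v w → Star (rot v) p w
      orbit = proj₂ (proj₂ (proj₂ (proj₂ rotation))) v p w
      go : ∀ {s} → s ≡ p ⊎ s ≡ q → Star (rot v) s w → w ≡ p ⊎ w ≡ q
      go s∈ ε = s∈
      go (inj₁ refl) (r ◅ rs) = go (inj₂ (rot-functional r pq)) rs
      go (inj₂ refl) (r ◅ rs) = go (inj₁ (rot-functional r qp)) rs

  module _ (simple : IsSimple G) where

    edge-sym : ∀ {v w} → Edge G v w → Edge G w v
    edge-sym {v} {w} = subst T (proj₂ simple v w)

    edge-≢ : ∀ {v w} → Edge G v w → v ≢ w
    edge-≢ {v} e refl = subst T (proj₁ simple v) e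

punchIn-preimage : ∀ {m} {u v : Fin (suc m)} → u ≢ v → ∃[ x ] punchIn u x ≡ v
punchIn-preimage u≢v = punchOut u≢v , punchIn-punchOut u≢v

module Extension {m : ℕ} (J : Map (suc m)) (simple : IsSimple J) (rotation : IsRotationSystem J)
  (c : Fin (suc m) → Fin 3) (u : Fin (suc m)) (k : Fin m → Bool) where

  J-u : Map m
  J-u = deleteVertex J u

  ι : Fin m → Fin (suc m)
  ι = punchIn u

  ≢-from-ι : ∀ {x y} → ι x ≢ ι y → x ≢ y
  ≢-from-ι ιx≢ιy = ιx≢ιy ∘ cong ι

  extend : Bool → Fin (suc m) → Bool
  extend β v with u ≟ v
  ... | yes _   = β
  ... | no u≢v = k (punchOut u≢v)

  extend-u : ∀ β → extend β u ≡ β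
  extend-u β with u ≟ u
  ... | yes _   = refl
  ... | no u≢u = ⊥-elim (u≢u refl)

  extend-ι : ∀ β x → extend β (ι x) ≡ k x
  extend-ι β x with u ≟ ι x
  ... | yes u≡ιx = ⊥-elim (punchInᵢ≢i u x (sym u≡ιx))
  ... | no u≢ιx  = cong k (punchIn-injective u _ _ (punchIn-punchOut u≢ιx))

  good-ι : ∀ β {x y} → Good (k x) (c (ι x)) (k y) (c (ι y)) → GoodPair J c (extend β) (ι x) (ι y)
  good-ι β {x} {y} = subst₂ (λ κ κ′ → Good κ (c (ι x)) κ′ (c (ι y))) (sym (extend-ι β x)) (sym (extend-ι β y))

  good-u : ∀ β {x} → Good β (c u) (k x) (c (ι x)) → GoodPair J c (extend β) u (ι x)
  good-u β {x} = subst₂ (λ κ κ′ → Good κ (c u) κ′ (c (ι x))) (sym (extend-u β)) (sym (extend-ι β x))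

  Face4-ι : ∀ {x₀ x₁ x₂ x₃} → Face4 J (ι x₀) (ι x₁) (ι x₂) (ι x₃) → Face4 J-u x₀ x₁ x₂ x₃
  Face4-ι ((d₀₁ , d₀₂ , d₀₃ , d₁₂ , d₁₃ , d₂₃) , r₁ , r₂ , r₃ , r₀) =
      (≢-from-ι d₀₁ , ≢-from-ι d₀₂ , ≢-from-ι d₀₃ , ≢-from-ι d₁₂ , ≢-from-ι d₁₃ , ≢-from-ι d₂₃)
    , inj₁ r₁ , inj₁ r₂ , inj₁ r₃ , inj₁ r₀

  GoodAtU : Bool → Set
  GoodAtU β = ∀ v₁ v₂ v₃ → Face4 J u v₁ v₂ v₃ →
    GoodPair J c (extend β) u v₂ ⊎ GoodPair J c (extend β) v₁ v₃

  u-or-ι : ∀ v → u ≡ v ⊎ ∃[ x ] ι x ≡ v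
  u-or-ι v with u ≟ v
  ... | yes u≡v = inj₁ u≡v
  ... | no u≢v  = inj₂ (punchIn-preimage u≢v)

  extend-compatible : ∀ {β} → GoodAtU β → Compatible J-u (c ∘ ι) k → Compatible J c (extend β)
  extend-compatible {β} at-u compatible v₀ v₁ v₂ v₃ F
    with u-or-ι v₀ | u-or-ι v₁ | u-or-ι v₂ | u-or-ι v₃
  ... | inj₁ refl | _ | _ | _ = at-u v₁ v₂ v₃ F
  ... | inj₂ _ | inj₁ refl | _ | _ =
    swap (map₂ good-sym (at-u _ _ _ (rotate-Face4 J F)))
  ... | inj₂ _ | inj₂ _ | inj₁ refl | _ =
    map good-sym good-sym (at-u _ _ _ (rotate-Face4 J (rotate-Face4 J F)))
  ... | inj₂ _ | inj₂ _ | inj₂ _ | inj₁ refl =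
    swap (map₁ good-sym (at-u _ _ _ (rotate-Face4 J (rotate-Face4 J (rotate-Face4 J F)))))
  ... | inj₂ (x₀ , refl) | inj₂ (x₁ , refl) | inj₂ (x₂ , refl) | inj₂ (x₃ , refl) =
    map (good-ι β) (good-ι β) (compatible x₀ x₁ x₂ x₃ (Face4-ι F))

  restrict-cycle : ∀ {ℓ f} → (∀ i → u ≢ f i) → IsCycleSeq J ℓ f →
    ∃[ f′ ] IsCycleSeq J-u ℓ f′ × (∀ i → ι (f′ i) ≡ f i)
  restrict-cycle {ℓ} {f} avoids (injective , path , closing) =
    f′ , (injective′ , path′ , closing′) , ι∘f′
    where
    f′ : Fin (3 + ℓ) → Fin m
    f′ i = proj₁ (punchIn-preimage (avoids i))
    ι∘f′ : ∀ i → ι (f′ i) ≡ f i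
    ι∘f′ i = proj₂ (punchIn-preimage (avoids i))
    edge′ : ∀ {i j} → Edge J (f i) (f j) → Edge J-u (f′ i) (f′ j)
    edge′ = subst₂ (Edge J) (sym (ι∘f′ _)) (sym (ι∘f′ _))
    injective′ : Injective _≡_ _≡_ f′
    injective′ {i} {j} f′i≡f′j = injective (trans (sym (ι∘f′ i)) (trans (cong ι f′i≡f′j) (ι∘f′ j)))
    path′ : ∀ i → Edge J-u (f′ (inject₁ i)) (f′ (suc i))
    path′ i = edge′ (path i)
    closing′ : Edge J-u (f′ (fromℕ (2 + ℓ))) (f′ zero)
    closing′ = edge′ closing

  Admissible : Fin m → Fin m → Bool → Set
  Admissible a′ b′ β = ¬ (k a′ ≡ β × k b′ ≡ β) × GoodAtU β

  module Neighbours (a′ b′ : Fin m) (u-a : Edge J u (ι a′)) (u-b : Edge J u (ι b′))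
    (neighbours : ∀ w → Edge J u w → w ≡ ι a′ ⊎ w ≡ ι b′) where

    a b : Fin (suc m)
    a = ι a′
    b = ι b′

    cycle-through-u : ∀ {ℓ f i} → IsCycleSeq J ℓ f → f i ≡ u → ∃₂ λ j j′ → f j ≡ a × f j′ ≡ b
    cycle-through-u {f = f} {i} cycle fi≡u with cycle-neighbours J (edge-sym J simple) cycle i
    ... | j , j′ , j≢j′ , e , e′
      with neighbours _ (subst (λ v → Edge J v (f j)) fi≡u e) | neighbours _ (subst (λ v → Edge J v (f j′)) fi≡u e′)
    ... | inj₁ fj≡a | inj₁ fj′≡a = ⊥-elim (j≢j′ (proj₁ cycle (trans fj≡a (sym fj′≡a))))
    ... | inj₁ fj≡a | inj₂ fj′≡b = j , j′ , fj≡a , fj′≡b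
    ... | inj₂ fj≡b | inj₁ fj′≡a = j′ , j , fj′≡a , fj≡b
    ... | inj₂ fj≡b | inj₂ fj′≡b = ⊥-elim (j≢j′ (proj₁ cycle (trans fj≡b (sym fj′≡b))))

    extend-forest : ∀ {β t} → ¬ (k a′ ≡ β × k b′ ≡ β) →
      InducesForest J-u (λ v → k v ≡ t) → InducesForest J (λ v → extend β v ≡ t)
    extend-forest {β} {t} split forest ℓ f cycle coloured with any? (λ i → f i ≟ u)
    ... | yes (i , fi≡u) with cycle-through-u cycle fi≡u
    ...   | j , j′ , fj≡a , fj′≡b = split (k-β j fj≡a , k-β j′ fj′≡b)
      where
      β≡t : β ≡ t
      β≡t = trans (sym (extend-u β)) (subst (λ v → extend β v ≡ t) fi≡u (coloured i))
      k-β : ∀ j {x} → f j ≡ ι x → k x ≡ β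
      k-β j {x} fj≡ιx = trans (sym (extend-ι β x))
        (trans (subst (λ v → extend β v ≡ t) fj≡ιx (coloured j)) (sym β≡t))
    extend-forest {β} {t} split forest ℓ f cycle coloured | no avoids
      with restrict-cycle (λ i u≡fi → avoids (i , sym u≡fi)) cycle
    ... | f′ , cycle′ , ι∘f′ = forest ℓ f′ cycle′ λ i →
      trans (sym (extend-ι β (f′ i))) (subst (λ v → extend β v ≡ t) (sym (ι∘f′ i)) (coloured i))

    ≢a⇒≡b : ∀ {w} → Edge J u w → a ≢ w → w ≡ b
    ≢a⇒≡b u-w a≢w with neighbours _ u-w
    ... | inj₁ w≡a = ⊥-elim (a≢w (sym w≡a))
    ... | inj₂ w≡b = w≡b

    ≢b⇒≡a : ∀ {w} → Edge J u w → b ≢ w → w ≡ a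
    ≢b⇒≡a u-w b≢w with neighbours _ u-w
    ... | inj₁ w≡a = w≡a
    ... | inj₂ w≡b = ⊥-elim (b≢w (sym w≡b))

    OppositeGood : Bool → Fin (suc m) → Set
    OppositeGood β w = ∀ v₂ v₃ → Face4 J u w v₂ v₃ → GoodPair J c (extend β) u v₂

    -- The face to the right of the dart u → w is unique, so it cannot be both a triangle and a square.
    triangle⇒opposite-good : ∀ {β w x} → Face3 J u w x → OppositeGood β w
    triangle⇒opposite-good ((_ , _ , _) , w-u-x , x-w-u , _) v₂ v₃ ((_ , _ , u≢v₃ , _) , w-u-v₂ , v₂-w-v₃ , _) =
      ⊥-elim (u≢v₃ (rot-functional J rotation
        (subst (λ z → Map.rot J z _ u) (rot-functional J rotation w-u-x w-u-v₂) x-w-u) v₂-w-v₃))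

    square⇒opposite-good : ∀ {β w x z} → Face4 J u w x z → GoodPair J c (extend β) u x → OppositeGood β w
    square⇒opposite-good {β} (_ , w-u-x , _) good v₂ v₃ (_ , w-u-v₂ , _) =
      subst (GoodPair J c (extend β) u) (rot-functional J rotation w-u-x w-u-v₂) good

    opposites⇒good-at-u : ∀ {β} → OppositeGood β a → OppositeGood β b → GoodAtU β
    opposites⇒good-at-u at-a at-b v₁ v₂ v₃ F@(_ , v₁-u-v₂ , _)
      with neighbours v₁ (edge-sym J simple (proj₁ (rot-edges J rotation v₁-u-v₂)))
    ... | inj₁ refl = inj₁ (at-a v₂ v₃ F)
    ... | inj₂ refl = inj₁ (at-b v₂ v₃ F)

    good-neighbours⇒good-at-u : ∀ {β} → GoodPair J c (extend β) a b → GoodAtU β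
    good-neighbours⇒good-at-u good v₁ v₂ v₃ ((_ , _ , _ , _ , v₁≢v₃ , _) , _ , _ , _ , u-v₃-v₁)
      with neighbours v₁ (proj₂ (rot-edges J rotation u-v₃-v₁)) | neighbours v₃ (proj₁ (rot-edges J rotation u-v₃-v₁))
    ... | inj₁ refl | inj₁ refl = ⊥-elim (v₁≢v₃ refl)
    ... | inj₁ refl | inj₂ refl = inj₂ good
    ... | inj₂ refl | inj₁ refl = inj₂ (good-sym good)
    ... | inj₂ refl | inj₂ refl = ⊥-elim (v₁≢v₃ refl)

    split-by-not : ¬ (k a′ ≡ not (k a′) × k b′ ≡ not (k a′))
    split-by-not (k≡not , _) = b≢not-b (k a′) k≡not

    triangles-choice : ∀ {x y} → Face3 J u a x → Face3 J u b y → ∃ (Admissible a′ b′)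
    triangles-choice tri-a tri-b =
        not (k a′) , split-by-not
      , opposites⇒good-at-u (triangle⇒opposite-good tri-a) (triangle⇒opposite-good tri-b)

    -- The triangle u a b forces c y = c u, so β = k y makes u agree with y.
    triangle-square-choice : ProperColouring J c → (∀ t → InducesForest J-u (λ v → k v ≡ t)) →
      ∀ {x y z} → Face3 J u a x → Face4 J u b y z → ∃ (Admissible a′ b′)
    triangle-square-choice proper forest
      tri@((_ , a≢x , _) , a-u-x , _ , u-x-a) sq@((_ , u≢y , _ , b≢y , b≢z , y≢z) , b-u-y , y-b-z , z-y-u , u-z-b)
      with ≢a⇒≡b (proj₁ (rot-edges J rotation u-x-a)) a≢x | ≢b⇒≡a (proj₁ (rot-edges J rotation u-z-b)) b≢z
         | punchIn-preimage u≢y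
    ... | refl | refl | y′ , refl =
        k y′
      , triangle-not-monochromatic J-u k forest (≢-from-ι a≢x) (≢-from-ι (≢-sym y≢z)) (≢-from-ι b≢y)
          a-b b-y (proj₂ (rot-edges J rotation y-b-z))
      , opposites⇒good-at-u (triangle⇒opposite-good tri) (square⇒opposite-good sq (good-u _ (inj₁ (refl , sym cy≡cu))))
      where
      a-b : Edge J a b
      a-b = proj₂ (rot-edges J rotation a-u-x)
      b-y : Edge J b (ι y′)
      b-y = proj₂ (rot-edges J rotation b-u-y)
      cy≡cu : c (ι y′) ≡ c u
      cy≡cu = third-colour (proper _ _ a-b) (proper _ _ (edge-sym J simple u-a)) (proper _ _ (edge-sym J simple u-b))
        (proper _ _ (edge-sym J simple (proj₁ (rot-edges J rotation z-y-u)))) (proper _ _ (edge-sym J simple b-y))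

    squares⇒cycle-graph : Connected J → ∀ {x} → Face4 J u a x b → Face4 J u b x a → IsCycleGraph J
    squares⇒cycle-graph connected
      ((u≢a , u≢x , u≢b , a≢x , a≢b , x≢b) , a-u-x , x-a-b , b-x-u , _) (_ , b-u-x , x-b-a , a-x-u , _) =
      connected-cycle-graph J connected
        (square-cycle J u≢a u≢x u≢b a≢x a≢b x≢b u-a (proj₂ (rot-edges J rotation a-u-x))
          (proj₂ (rot-edges J rotation x-a-b)) (proj₂ (rot-edges J rotation b-x-u)))
        closed
      where
      around : ∀ {v p q} → Map.rot J v p q → Map.rot J v q p → ∀ w → Edge J v w → w ≡ p ⊎ w ≡ q
      around = rot-involution-neighbours J rotation
      closed : ∀ i w → Edge J (lookup (u ∷ a ∷ _ ∷ b ∷ []) i) w → CycleEdge J 1 (lookup (u ∷ a ∷ _ ∷ b ∷ [])) _ w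
      closed zero w e with neighbours w e
      ... | inj₁ w≡a = inj₁ (zero , inj₁ (refl , sym w≡a))
      ... | inj₂ w≡b = inj₂ (inj₂ (sym w≡b , refl))
      closed (suc zero) w e with around a-u-x a-x-u w e
      ... | inj₁ w≡u = inj₁ (zero , inj₂ (sym w≡u , refl))
      ... | inj₂ w≡x = inj₁ (suc zero , inj₁ (refl , sym w≡x))
      closed (suc (suc zero)) w e with around x-a-b x-b-a w e
      ... | inj₁ w≡a = inj₁ (suc zero , inj₂ (sym w≡a , refl))
      ... | inj₂ w≡b = inj₁ (suc (suc zero) , inj₁ (refl , sym w≡b))
      closed (suc (suc (suc zero))) w e with around b-x-u b-u-x w e
      ... | inj₁ w≡x = inj₁ (suc (suc zero) , inj₂ (sym w≡x , refl))
      ... | inj₂ w≡u = inj₂ (inj₁ (refl , sym w≡u))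

    -- a x b y is a facial 4-cycle of J - u, so x and y form a good pair, and it is not monochromatic.
    distinct-squares-choice : ProperColouring J c → Compatible J-u (c ∘ ι) k →
      (∀ t → InducesForest J-u (λ v → k v ≡ t)) → ¬ Good (k a′) (c a) (k b′) (c b) →
      ∀ {x′ y′} → x′ ≢ y′ → Face4 J u a (ι x′) b → Face4 J u b (ι y′) a → ∃ (Admissible a′ b′)
    distinct-squares-choice proper compatible forest ¬good-ab {x′} {y′} x′≢y′
      sq-a@((_ , _ , _ , a≢x , a≢b , x≢b) , a-u-x , x-a-b , b-x-u , _)
      sq-b@((_ , _ , _ , b≢y , _ , y≢a) , b-u-y , y-b-a , a-y-u , _) =
      admissible (square-label-choice (c a) (c b) (c u) (c (ι x′)) (c (ι y′)) (k a′) (k b′) (k x′) (k y′)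
        (colour-≢ (edge-sym J simple u-a)) (colour-≢ (edge-sym J simple u-b))
        (colour-≢ a-x) (colour-≢ (edge-sym J simple x-b)) (colour-≢ a-y) (colour-≢ b-y)
        ¬good-ab good-xy
        (square-not-monochromatic J-u k forest a′≢x′ a′≢b′ (≢-sym y′≢a′) x′≢b′ x′≢y′ b′≢y′ a-x x-b b-y y-a))
      where
      colour-≢ : ∀ {v w} → Edge J v w → c v ≢ c w
      colour-≢ = proper _ _
      a′≢x′ : a′ ≢ x′
      a′≢x′ = ≢-from-ι a≢x
      a′≢b′ : a′ ≢ b′
      a′≢b′ = ≢-from-ι a≢b
      x′≢b′ : x′ ≢ b′
      x′≢b′ = ≢-from-ι x≢b
      b′≢y′ : b′ ≢ y′
      b′≢y′ = ≢-from-ι b≢y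
      y′≢a′ : y′ ≢ a′
      y′≢a′ = ≢-from-ι y≢a
      a-x : Edge J a (ι x′)
      a-x = proj₂ (rot-edges J rotation a-u-x)
      x-b : Edge J (ι x′) b
      x-b = proj₂ (rot-edges J rotation x-a-b)
      b-y : Edge J b (ι y′)
      b-y = proj₂ (rot-edges J rotation b-u-y)
      y-a : Edge J (ι y′) a
      y-a = proj₂ (rot-edges J rotation y-b-a)
      a-y : Edge J a (ι y′)
      a-y = proj₁ (rot-edges J rotation a-y-u)
      face : Face4 J-u a′ x′ b′ y′
      face = (a′≢x′ , a′≢b′ , ≢-sym y′≢a′ , x′≢b′ , x′≢y′ , b′≢y′)
           , inj₁ x-a-b , inj₂ (b-x-u , b-u-y) , inj₁ y-b-a , inj₂ (a-y-u , a-u-x)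
      good-xy : Good (k x′) (c (ι x′)) (k y′) (c (ι y′))
      good-xy with compatible a′ x′ b′ y′ face
      ... | inj₁ good-ab = ⊥-elim (¬good-ab good-ab)
      ... | inj₂ good-xy = good-xy
      admissible : (∃ λ β → Good β (c u) (k x′) (c (ι x′)) × Good β (c u) (k y′) (c (ι y′)) × ¬ (k a′ ≡ β × k b′ ≡ β)) →
        ∃ (Admissible a′ b′)
      admissible (β , good-ux , good-uy , split) =
          β , split
        , opposites⇒good-at-u (square⇒opposite-good sq-a (good-u β good-ux)) (square⇒opposite-good sq-b (good-u β good-uy))

    squares-choice : ProperColouring J c → Connected J → ¬ IsCycleGraph J →
      Compatible J-u (c ∘ ι) k → (∀ t → InducesForest J-u (λ v → k v ≡ t)) →
      ∀ {x y z z′} → Face4 J u a x z → Face4 J u b y z′ → ∃ (Admissible a′ b′)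
    squares-choice proper connected not-cycle compatible forest
      sq-a@((_ , u≢x , _ , _ , a≢z , _) , _ , _ , _ , u-z-a) sq-b@((_ , u≢y , _ , _ , b≢z′ , _) , _ , _ , _ , u-z′-b)
      with ≢a⇒≡b (proj₁ (rot-edges J rotation u-z-a)) a≢z | ≢b⇒≡a (proj₁ (rot-edges J rotation u-z′-b)) b≢z′
         | punchIn-preimage u≢x | punchIn-preimage u≢y
    ... | refl | refl | x′ , refl | y′ , refl with good? (k a′) (c a) (k b′) (c b) | x′ ≟ y′
    ...   | yes good-ab | _ =
        not (k a′) , split-by-not , good-neighbours⇒good-at-u (good-ι _ good-ab)
    ...   | no _        | yes refl = ⊥-elim (not-cycle (squares⇒cycle-graph connected sq-a sq-b))
    ...   | no ¬good-ab | no x′≢y′ = distinct-squares-choice proper compatible forest ¬good-ab x′≢y′ sq-a sq-b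

  neighbours-of-u : degree J u ≡ 2 →
    ∃₂ λ a′ b′ → Edge J u (ι a′) × Edge J u (ι b′) × (∀ w → Edge J u w → w ≡ ι a′ ⊎ w ≡ ι b′)
  neighbours-of-u deg with degree-two-neighbours J deg
  ... | a , b , u-a , u-b , only with punchIn-preimage (edge-≢ J simple u-a) | punchIn-preimage (edge-≢ J simple u-b)
  ... | a′ , refl | b′ , refl = a′ , b′ , u-a , u-b , only

  admissible-choice : ProperColouring J c → Connected J → ¬ IsCycleGraph J →
    Compatible J-u (c ∘ ι) k → (∀ t → InducesForest J-u (λ v → k v ≡ t)) →
    (∀ v₀ v₁ → Edge J v₀ v₁ → (∃[ v₂ ] Face3 J v₀ v₁ v₂) ⊎ (∃[ v₂ ] ∃[ v₃ ] Face4 J v₀ v₁ v₂ v₃)) →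
    ∀ {a′ b′} → Edge J u (ι a′) → Edge J u (ι b′) → (∀ w → Edge J u w → w ≡ ι a′ ⊎ w ≡ ι b′) →
    ∃ (Admissible a′ b′)
  admissible-choice proper connected not-cycle compatible forest faces {a′} {b′} u-a u-b neighbours =
    choose (faces u (ι a′) u-a) (faces u (ι b′) u-b)
    where
    open Neighbours a′ b′ u-a u-b neighbours
    module swapped = Neighbours b′ a′ u-b u-a (λ w u-w → swap (neighbours w u-w))
    choose : (∃[ x ] Face3 J u a x) ⊎ (∃[ x ] ∃[ z ] Face4 J u a x z) →
             (∃[ y ] Face3 J u b y) ⊎ (∃[ y ] ∃[ z ] Face4 J u b y z) → ∃ (Admissible a′ b′)
    choose (inj₁ (_ , tri-a)) (inj₁ (_ , tri-b)) = triangles-choice tri-a tri-b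
    choose (inj₁ (_ , tri-a)) (inj₂ (_ , _ , sq-b)) = triangle-square-choice proper forest tri-a sq-b
    choose (inj₂ (_ , _ , sq-a)) (inj₁ (_ , tri-b)) =
      let β , (split , at-u) = swapped.triangle-square-choice proper forest tri-b sq-a
      in β , (λ (ka , kb) → split (kb , ka)) , at-u
    choose (inj₂ (_ , _ , sq-a)) (inj₂ (_ , _ , sq-b)) =
      squares-choice proper connected not-cycle compatible forest sq-a sq-b

lemma3p2 : {m : ℕ} (J : Map (suc m)) → InTheta J → ¬ IsCycleGraph J →
    (c : Fin (suc m) → Fin 3) → ProperColouring J c →
    (u : Fin (suc m)) → degree J u ≡ 2 →
    (k : Fin m → Bool) →
    Compatible (deleteVertex J u) (λ v → c (punchIn u v)) k →
    InducesForest (deleteVertex J u) (λ v → k v ≡ true) →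
    InducesForest (deleteVertex J u) (λ v → k v ≡ false) →
    ∃[ K ] (Compatible J c K
      × InducesForest J (λ v → K v ≡ true)
      × InducesForest J (λ v → K v ≡ false))
lemma3p2 J (_ , _ , (simple , rotation , connected , _) , faces) not-cycle c proper u deg k compatible forest-true forest-false =
  let a′ , b′ , u-a , u-b , neighbours = neighbours-of-u deg
      β , split , at-u = admissible-choice proper connected not-cycle compatible forest faces u-a u-b neighbours
      open Neighbours a′ b′ u-a u-b neighbours
  in extend β , extend-compatible at-u compatible , extend-forest split forest-true , extend-forest split forest-false
  where
  open Extension J simple rotation c u k
  forest : ∀ t → InducesForest J-u (λ v → k v ≡ t)
  forest true  = forest-true
  forest false = forest-false
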